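{- For each integer $r$ and each non-negative integer $n$, \[ \sum_{k = 0}^n \binom {2k}{k} \binom {2(n - k)}{n-k} F_{2k+r} = \sum_{k = 0}^n \binom {n}{k}^2 F_{6k-2n+r}, \qquad \sum_{k = 0}^n \binom {2k}{k} \binom {2(n - k)}{n-k} L_{2k+r} = \sum_{k = 0}^n \binom {n}{k}^2 L_{6k-2n+r}. \]
   Context: $F_j$ and $L_j$ denote the Fibonacci and Lucas numbers: $F_0=0,F_1=1$, $L_0=2,L_1=1$, both satisfying $X_j=X_{j-1}+X_{j-2}$, extended to all integer indices via the recurrence (so $F_{ -j}=(-1)^{j+1}F_j$, $L_{ -j}=(-1)^jL_j$). -}

module Defs where

open import Data.Nat as ℕ using (ℕ; zero; suc)
open import Data.Integer using (ℤ; +_; -[1+_]; _+_; _-_; _*_)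
open import Data.Product using (_×_; _,_; proj₁)

-- Generic integer-indexed sequence satisfying X_j = X_{j-1} + X_{j-2},
-- determined by initial values X_0 = a, X_1 = b.
-- forward: (X_j , X_{j+1}) for j ≥ 0
fwd : ℤ → ℤ → ℕ → ℤ × ℤ
fwd a b zero = a , b
fwd a b (suc j) with fwd a b j
... | (x , y) = y , x + y

-- backward: (X_{-j} , X_{-j+1}) for j ≥ 0, using X_{m-1} = X_{m+1} - X_m
bwd : ℤ → ℤ → ℕ → ℤ × ℤ
bwd a b zero = a , b
bwd a b (suc j) with bwd a b j
... | (x , y) = y - x , x

seqℤ : ℤ → ℤ → ℤ → ℤ
seqℤ a b (+ j)     = proj₁ (fwd a b j)
seqℤ a b -[1+ j ]  = proj₁ (bwd a b (suc j))

F : ℤ → ℤ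
F = seqℤ (+ 0) (+ 1)

L : ℤ → ℤ
L = seqℤ (+ 2) (+ 1)

sumTo : ℕ → (ℕ → ℤ) → ℤ
sumTo zero f = f zero
sumTo (suc n) f = sumTo n f + f (suc n)

{-# OPTIONS --safe #-}
-- Both sides, as functions X n r of n and of the index shift r, satisfy
--   (n+2) X (n+2) r = (4n+6) (X (n+1) r + X (n+1) (r+2)) - 16 (n+1) X n (r+2)
-- and agree for n = 0, 1.  Write both as sums over i + j = n (i = k, j = n - k) and
-- weight the summands by i and by j: the absorption identities
-- (i+1) C(2i+2,i+1) = (4i+2) C(2i,i) and (i+1) C(i+j+1,i+1) = (i+j+1) C(i+j,i) turn these
-- moments into sums of size n - 1 at shifted r, and eliminating the moments gives the
-- recurrence.  On the right this only yields a relation among the shifts r+4, r-2, r+8, r-4;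
-- it collapses to the same recurrence because every Fibonacci-like G satisfies
-- G (m+2) + G (m-2) = 3 G m, and hence so does every moment as a function of r.
module Submission where

open import Defs
open import Data.Nat as ℕ using (ℕ; zero; suc; _∸_; z≤n)
open import Data.Nat.Combinatorics using (_C_; nCn≡1; nCk+nC[k+1]≡[n+1]C[k+1])
open import Data.Integer using (ℤ; +_; -[1+_]; _+_; _-_; -_; _*_; _^_)
open import Data.List using (_∷_; [])
open import Data.Product using (_×_; _,_; proj₁)
open import Relation.Binary.PropositionalEquality
  using (_≡_; refl; sym; trans; cong; cong₂; module ≡-Reasoning)
open import Data.Integer.Tactic.RingSolver using (solve-∀; solve)
import Data.Nat.Tactic.RingSolver as ℕ-Solver
import Data.Nat.Properties as ℕP
import Data.Integer.Properties as ℤP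

open ≡-Reasoning

sumAntidiagonal : ℕ → (ℕ → ℕ → ℤ) → ℤ
sumAntidiagonal zero    f = f 0 0
sumAntidiagonal (suc n) f = f 0 (suc n) + sumAntidiagonal n (λ i j → f (suc i) j)

sumAntidiagonal-cong : ∀ n {f g : ℕ → ℕ → ℤ} → (∀ i j → f i j ≡ g i j) →
                       sumAntidiagonal n f ≡ sumAntidiagonal n g
sumAntidiagonal-cong zero    f≡g = f≡g 0 0
sumAntidiagonal-cong (suc n) f≡g =
  cong₂ _+_ (f≡g 0 (suc n)) (sumAntidiagonal-cong n (λ i j → f≡g (suc i) j))

sumAntidiagonal-+ : ∀ n (f g : ℕ → ℕ → ℤ) →
  sumAntidiagonal n (λ i j → f i j + g i j) ≡ sumAntidiagonal n f + sumAntidiagonal n g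
sumAntidiagonal-+ zero    f g = refl
sumAntidiagonal-+ (suc n) f g = begin
  (f 0 (suc n) + g 0 (suc n)) + sumAntidiagonal n (λ i j → f (suc i) j + g (suc i) j)
    ≡⟨ cong (_+_ (f 0 (suc n) + g 0 (suc n))) (sumAntidiagonal-+ n f′ g′) ⟩
  (f 0 (suc n) + g 0 (suc n)) + (sumAntidiagonal n f′ + sumAntidiagonal n g′)
    ≡⟨ interchange (f 0 (suc n)) (g 0 (suc n)) (sumAntidiagonal n f′) (sumAntidiagonal n g′) ⟩
  (f 0 (suc n) + sumAntidiagonal n f′) + (g 0 (suc n) + sumAntidiagonal n g′) ∎
  where
  f′ g′ : ℕ → ℕ → ℤ
  f′ i j = f (suc i) j
  g′ i j = g (suc i) j
  interchange : ∀ a b c d → (a + b) + (c + d) ≡ (a + c) + (b + d)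
  interchange = solve-∀

sumAntidiagonal-*ˡ : ∀ n c (f : ℕ → ℕ → ℤ) →
  sumAntidiagonal n (λ i j → c * f i j) ≡ c * sumAntidiagonal n f
sumAntidiagonal-*ˡ zero    c f = refl
sumAntidiagonal-*ˡ (suc n) c f =
  trans (cong (_+_ (c * f 0 (suc n))) (sumAntidiagonal-*ˡ n c f′))
        (sym (ℤP.*-distribˡ-+ c (f 0 (suc n)) (sumAntidiagonal n f′)))
  where
  f′ : ℕ → ℕ → ℤ
  f′ i j = f (suc i) j

sumAntidiagonal-sucʳ : ∀ n (f : ℕ → ℕ → ℤ) →
  sumAntidiagonal (suc n) f ≡ sumAntidiagonal n (λ i j → f i (suc j)) + f (suc n) 0
sumAntidiagonal-sucʳ zero    f = refl
sumAntidiagonal-sucʳ (suc n) f =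
  trans (cong (_+_ (f 0 (suc (suc n)))) (sumAntidiagonal-sucʳ n (λ i j → f (suc i) j)))
        (sym (ℤP.+-assoc (f 0 (suc (suc n))) (sumAntidiagonal n (λ i j → f (suc i) (suc j)))
                         (f (suc (suc n)) 0)))

sumAntidiagonal-dropˡ : ∀ n (f : ℕ → ℕ → ℤ) → f 0 (suc n) ≡ + 0 →
  sumAntidiagonal (suc n) f ≡ sumAntidiagonal n (λ i j → f (suc i) j)
sumAntidiagonal-dropˡ n f f₀≡0 =
  trans (cong (_+ sumAntidiagonal n (λ i j → f (suc i) j)) f₀≡0)
        (ℤP.+-identityˡ (sumAntidiagonal n (λ i j → f (suc i) j)))

sumAntidiagonal-dropʳ : ∀ n (f : ℕ → ℕ → ℤ) → f (suc n) 0 ≡ + 0 →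
  sumAntidiagonal (suc n) f ≡ sumAntidiagonal n (λ i j → f i (suc j))
sumAntidiagonal-dropʳ n f f₀≡0 =
  trans (sumAntidiagonal-sucʳ n f)
    (trans (cong (_+_ (sumAntidiagonal n (λ i j → f i (suc j)))) f₀≡0)
           (ℤP.+-identityʳ (sumAntidiagonal n (λ i j → f i (suc j)))))

sumAntidiagonal-weight : ∀ n (φ : ℕ → ℤ) (f : ℕ → ℕ → ℤ) →
  sumAntidiagonal n (λ i j → φ (i ℕ.+ j) * f i j) ≡ φ n * sumAntidiagonal n f
sumAntidiagonal-weight zero    φ f = refl
sumAntidiagonal-weight (suc n) φ f =
  trans (cong (_+_ (φ (suc n) * f 0 (suc n))) (sumAntidiagonal-weight n (λ k → φ (suc k)) f′))
        (sym (ℤP.*-distribˡ-+ (φ (suc n)) (f 0 (suc n)) (sumAntidiagonal n f′)))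
  where
  f′ : ℕ → ℕ → ℤ
  f′ i j = f (suc i) j

sumAntidiagonal-split : ∀ n (f : ℕ → ℕ → ℤ) →
  + n * sumAntidiagonal n f
    ≡ sumAntidiagonal n (λ i j → + i * f i j) + sumAntidiagonal n (λ i j → + j * f i j)
sumAntidiagonal-split n f = begin
  + n * sumAntidiagonal n f
    ≡⟨ sumAntidiagonal-weight n +_ f ⟨
  sumAntidiagonal n (λ i j → (+ i + + j) * f i j)
    ≡⟨ sumAntidiagonal-cong n (λ i j → ℤP.*-distribʳ-+ (f i j) (+ i) (+ j)) ⟩
  sumAntidiagonal n (λ i j → + i * f i j + + j * f i j)
    ≡⟨ sumAntidiagonal-+ n _ _ ⟩
  sumAntidiagonal n (λ i j → + i * f i j) + sumAntidiagonal n (λ i j → + j * f i j) ∎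

sumAntidiagonal-linear : ∀ n a b (f g : ℕ → ℕ → ℤ) →
  sumAntidiagonal n (λ i j → a * f i j + b * g i j)
    ≡ a * sumAntidiagonal n f + b * sumAntidiagonal n g
sumAntidiagonal-linear n a b f g =
  trans (sumAntidiagonal-+ n (λ i j → a * f i j) (λ i j → b * g i j))
        (cong₂ _+_ (sumAntidiagonal-*ˡ n a f) (sumAntidiagonal-*ˡ n b g))

sumTo-cong : ∀ n {f g : ℕ → ℤ} → (∀ k → k ℕ.≤ n → f k ≡ g k) → sumTo n f ≡ sumTo n g
sumTo-cong zero    f≡g = f≡g 0 z≤n
sumTo-cong (suc n) f≡g =
  cong₂ _+_ (sumTo-cong n (λ k k≤n → f≡g k (ℕP.m≤n⇒m≤1+n k≤n))) (f≡g (suc n) ℕP.≤-refl)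

sumAntidiagonal≡sumTo : ∀ n (f : ℕ → ℕ → ℤ) →
  sumAntidiagonal n f ≡ sumTo n (λ k → f k (n ∸ k))
sumAntidiagonal≡sumTo zero    f = refl
sumAntidiagonal≡sumTo (suc n) f = begin
  sumAntidiagonal (suc n) f
    ≡⟨ sumAntidiagonal-sucʳ n f ⟩
  sumAntidiagonal n (λ i j → f i (suc j)) + f (suc n) 0
    ≡⟨ cong₂ _+_ (sumAntidiagonal≡sumTo n _) (cong (f (suc n)) (sym (ℕP.n∸n≡0 n))) ⟩
  sumTo n (λ k → f k (suc (n ∸ k))) + f (suc n) (n ∸ n)
    ≡⟨ cong (_+ f (suc n) (n ∸ n))
            (sumTo-cong n (λ k k≤n → cong (f k) (sym (ℕP.+-∸-assoc 1 k≤n)))) ⟩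
  sumTo (suc n) (λ k → f k (suc n ∸ k)) ∎

pascal : ℕ → ℕ → ℕ
pascal zero    j       = 1
pascal (suc i) zero    = 1
pascal (suc i) (suc j) = pascal i (suc j) ℕ.+ pascal (suc i) j

pascal≡C : ∀ i j → pascal i j ≡ (i ℕ.+ j) C i
pascal≡C zero    j       = refl
pascal≡C (suc i) zero    = trans (sym (nCn≡1 (suc i))) (cong (_C suc i) (sym (ℕP.+-identityʳ (suc i))))
pascal≡C (suc i) (suc j) = begin
  pascal i (suc j) ℕ.+ pascal (suc i) j
    ≡⟨ cong₂ ℕ._+_ (pascal≡C i (suc j)) (pascal≡C (suc i) j) ⟩
  (i ℕ.+ suc j) C i ℕ.+ suc (i ℕ.+ j) C suc i
    ≡⟨ cong (λ m → m C i ℕ.+ suc (i ℕ.+ j) C suc i) (ℕP.+-suc i j) ⟩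
  suc (i ℕ.+ j) C i ℕ.+ suc (i ℕ.+ j) C suc i
    ≡⟨ nCk+nC[k+1]≡[n+1]C[k+1] (suc (i ℕ.+ j)) i ⟩
  suc (suc (i ℕ.+ j)) C suc i
    ≡⟨ cong (λ m → suc m C suc i) (ℕP.+-suc i j) ⟨
  (suc i ℕ.+ suc j) C suc i ∎

pascal-zeroʳ : ∀ i → pascal i 0 ≡ 1
pascal-zeroʳ zero    = refl
pascal-zeroʳ (suc i) = refl

mutual
  pascal-absorbˡ : ∀ i j → suc i ℕ.* pascal (suc i) j ≡ suc (i ℕ.+ j) ℕ.* pascal i j
  pascal-absorbˡ i zero    = begin
    suc i ℕ.* 1
      ≡⟨ cong₂ (λ m p → suc m ℕ.* p) (ℕP.+-identityʳ i) (pascal-zeroʳ i) ⟨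
    suc (i ℕ.+ 0) ℕ.* pascal i 0 ∎
  pascal-absorbˡ i (suc j) = begin
    suc i ℕ.* (pascal i (suc j) ℕ.+ pascal (suc i) j)
      ≡⟨ ℕP.*-distribˡ-+ (suc i) (pascal i (suc j)) _ ⟩
    suc i ℕ.* pascal i (suc j) ℕ.+ suc i ℕ.* pascal (suc i) j
      ≡⟨ cong (suc i ℕ.* pascal i (suc j) ℕ.+_) (pascal-absorbˡ i j) ⟩
    suc i ℕ.* pascal i (suc j) ℕ.+ suc (i ℕ.+ j) ℕ.* pascal i j
      ≡⟨ cong (suc i ℕ.* pascal i (suc j) ℕ.+_) (pascal-absorbʳ i j) ⟨
    suc i ℕ.* pascal i (suc j) ℕ.+ suc j ℕ.* pascal i (suc j)
      ≡⟨ ℕP.*-distribʳ-+ (pascal i (suc j)) (suc i) (suc j) ⟨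
    (suc i ℕ.+ suc j) ℕ.* pascal i (suc j)
      ≡⟨ cong (λ m → suc m ℕ.* pascal i (suc j)) (ℕP.+-suc i j) ⟩
    suc (suc (i ℕ.+ j)) ℕ.* pascal i (suc j)
      ≡⟨ cong (λ m → suc m ℕ.* pascal i (suc j)) (ℕP.+-suc i j) ⟨
    suc (i ℕ.+ suc j) ℕ.* pascal i (suc j) ∎

  pascal-absorbʳ : ∀ i j → suc j ℕ.* pascal i (suc j) ≡ suc (i ℕ.+ j) ℕ.* pascal i j
  pascal-absorbʳ zero    j = refl
  pascal-absorbʳ (suc i) j = begin
    suc j ℕ.* (pascal i (suc j) ℕ.+ pascal (suc i) j)
      ≡⟨ ℕP.*-distribˡ-+ (suc j) (pascal i (suc j)) _ ⟩
    suc j ℕ.* pascal i (suc j) ℕ.+ suc j ℕ.* pascal (suc i) j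
      ≡⟨ cong (ℕ._+ suc j ℕ.* pascal (suc i) j) (pascal-absorbʳ i j) ⟩
    suc (i ℕ.+ j) ℕ.* pascal i j ℕ.+ suc j ℕ.* pascal (suc i) j
      ≡⟨ cong (ℕ._+ suc j ℕ.* pascal (suc i) j) (pascal-absorbˡ i j) ⟨
    suc i ℕ.* pascal (suc i) j ℕ.+ suc j ℕ.* pascal (suc i) j
      ≡⟨ ℕP.*-distribʳ-+ (pascal (suc i) j) (suc i) (suc j) ⟨
    (suc i ℕ.+ suc j) ℕ.* pascal (suc i) j
      ≡⟨ cong (λ m → suc m ℕ.* pascal (suc i) j) (ℕP.+-suc i j) ⟩
    suc (suc i ℕ.+ j) ℕ.* pascal (suc i) j ∎

*≡*⇒pos*pos≡pos*pos : ∀ a b c d → a ℕ.* b ≡ c ℕ.* d → + a * + b ≡ + c * + d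
*≡*⇒pos*pos≡pos*pos a b c d eq =
  trans (sym (ℤP.pos-* a b)) (trans (cong +_ eq) (ℤP.pos-* c d))

central : ℕ → ℕ
central i = pascal i i

central≡C : ∀ k → central k ≡ (2 ℕ.* k) C k
central≡C k = trans (pascal≡C k k) (cong (λ m → (k ℕ.+ m) C k) (sym (ℕP.+-identityʳ k)))

central-absorb : ∀ i → suc i ℕ.* central (suc i) ≡ (4 ℕ.* i ℕ.+ 2) ℕ.* central i
central-absorb i = ℕP.*-cancelˡ-≡ _ _ (suc i) (begin
  suc i ℕ.* (suc i ℕ.* pascal (suc i) (suc i))
    ≡⟨ cong (suc i ℕ.*_) (pascal-absorbˡ i (suc i)) ⟩
  suc i ℕ.* (suc (i ℕ.+ suc i) ℕ.* pascal i (suc i))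
    ≡⟨ swap (suc i) (suc (i ℕ.+ suc i)) (pascal i (suc i)) ⟩
  suc (i ℕ.+ suc i) ℕ.* (suc i ℕ.* pascal i (suc i))
    ≡⟨ cong (suc (i ℕ.+ suc i) ℕ.*_) (pascal-absorbʳ i i) ⟩
  suc (i ℕ.+ suc i) ℕ.* (suc (i ℕ.+ i) ℕ.* pascal i i)
    ≡⟨ regroup i (pascal i i) ⟩
  suc i ℕ.* ((4 ℕ.* i ℕ.+ 2) ℕ.* pascal i i) ∎)
  where
  swap : ∀ a b c → a ℕ.* (b ℕ.* c) ≡ b ℕ.* (a ℕ.* c)
  swap = ℕ-Solver.solve-∀
  regroup : ∀ i c →
    suc (i ℕ.+ suc i) ℕ.* (suc (i ℕ.+ i) ℕ.* c) ≡ suc i ℕ.* ((4 ℕ.* i ℕ.+ 2) ℕ.* c)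
  regroup = ℕ-Solver.solve-∀

FibonacciRecurrence : (ℤ → ℤ) → Set
FibonacciRecurrence G = ∀ m → G (m + + 2) ≡ G (m + + 1) + G m

fwd-step : ∀ a b j → proj₁ (fwd a b (suc (suc j))) ≡ proj₁ (fwd a b (suc j)) + proj₁ (fwd a b j)
fwd-step a b j with fwd a b j
... | x , y = ℤP.+-comm x y

bwd-step : ∀ a b j → proj₁ (bwd a b j) ≡ proj₁ (bwd a b (suc j)) + proj₁ (bwd a b (suc (suc j)))
bwd-step a b j with bwd a b j
... | x , y = solve (x ∷ y ∷ [])

seqℤ-fibonacci : ∀ a b → FibonacciRecurrence (seqℤ a b)
seqℤ-fibonacci a b (+ j) rewrite ℕP.+-comm j 2 | ℕP.+-comm j 1 = fwd-step a b j
seqℤ-fibonacci a b -[1+ 0 ]           = b≡a+[b-a] a b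
  where
  b≡a+[b-a] : ∀ a b → b ≡ a + (b - a)
  b≡a+[b-a] = solve-∀
seqℤ-fibonacci a b -[1+ 1 ]           = bwd-step a b 0
seqℤ-fibonacci a b -[1+ suc (suc k) ] = bwd-step a b (suc k)

Skip2Recurrence : (ℤ → ℤ) → Set
Skip2Recurrence H = ∀ m → H (m + + 2) + H (m - + 2) ≡ + 3 * H m

fibonacci⇒skip2 : ∀ {G} → FibonacciRecurrence G → Skip2Recurrence G
fibonacci⇒skip2 {G} rec m = begin
  G (m + + 2) + G (m - + 2)
    ≡⟨ cong (_+ G (m - + 2)) (rec m) ⟩
  (G (m + + 1) + G m) + G (m - + 2)
    ≡⟨ cong (λ x → (x + G m) + G (m - + 2)) (rec-at (m - + 1) (solve (m ∷ [])) (solve (m ∷ []))) ⟩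
  ((G m + G (m - + 1)) + G m) + G (m - + 2)
    ≡⟨ regroup (G m) (G (m - + 1)) (G (m - + 2)) ⟩
  + 2 * G m + (G (m - + 1) + G (m - + 2))
    ≡⟨ cong (_+_ (+ 2 * G m)) (rec-at (m - + 2) (solve (m ∷ [])) (solve (m ∷ []))) ⟨
  + 2 * G m + G m
    ≡⟨ two-plus-one (G m) ⟩
  + 3 * G m ∎
  where
  rec-at : ∀ x {y z} → x + + 1 ≡ y → x + + 2 ≡ z → G z ≡ G y + G x
  rec-at x refl refl = rec x
  regroup : ∀ a b c → ((a + b) + a) + c ≡ + 2 * a + (b + c)
  regroup = solve-∀
  two-plus-one : ∀ a → + 2 * a + a ≡ + 3 * a
  two-plus-one = solve-∀

module _ {H : ℤ → ℤ} (skip2 : Skip2Recurrence H) where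

  private
    skip2-at : ∀ c {hi lo} → c + + 2 ≡ hi → c - + 2 ≡ lo → H hi + H lo ≡ + 3 * H c
    skip2-at c refl refl = skip2 c

  skip2-+4-2 : ∀ m → H (m + + 4) + H (m - + 2) ≡ + 2 * H m + + 2 * H (m + + 2)
  skip2-+4-2 m = begin
    H (m + + 4) + H (m - + 2)
      ≡⟨ regroup (H (m + + 4)) (H (m - + 2)) (H m) (H (m + + 2)) ⟩
    (H (m + + 4) + H m) + (H (m + + 2) + H (m - + 2)) - (H m + H (m + + 2))
      ≡⟨ cong₂ (λ x y → x + y - (H m + H (m + + 2)))
               (skip2-at (m + + 2) (solve (m ∷ [])) (solve (m ∷ []))) (skip2 m) ⟩
    + 3 * H (m + + 2) + + 3 * H m - (H m + H (m + + 2))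
      ≡⟨ collect (H m) (H (m + + 2)) ⟩
    + 2 * H m + + 2 * H (m + + 2) ∎
    where
    regroup : ∀ a b x y → a + b ≡ (a + x) + (y + b) - (x + y)
    regroup = solve-∀
    collect : ∀ x y → + 3 * y + + 3 * x - (x + y) ≡ + 2 * x + + 2 * y
    collect = solve-∀

  skip2-±4 : ∀ c → H (c + + 4) + H (c - + 4) ≡ + 7 * H c
  skip2-±4 c = begin
    H (c + + 4) + H (c - + 4)
      ≡⟨ regroup (H (c + + 4)) (H (c - + 4)) (H c) ⟩
    (H (c + + 4) + H c) + (H c + H (c - + 4)) - + 2 * H c
      ≡⟨ cong₂ (λ x y → x + y - + 2 * H c)
               (skip2-at (c + + 2) (solve (c ∷ [])) (solve (c ∷ [])))
               (skip2-at (c - + 2) (solve (c ∷ [])) (solve (c ∷ []))) ⟩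
    + 3 * H (c + + 2) + + 3 * H (c - + 2) - + 2 * H c
      ≡⟨ cong (_- + 2 * H c) (ℤP.*-distribˡ-+ (+ 3) (H (c + + 2)) (H (c - + 2))) ⟨
    + 3 * (H (c + + 2) + H (c - + 2)) - + 2 * H c
      ≡⟨ cong (λ x → + 3 * x - + 2 * H c) (skip2 c) ⟩
    + 3 * (+ 3 * H c) - + 2 * H c
      ≡⟨ collect (H c) ⟩
    + 7 * H c ∎
    where
    regroup : ∀ a b x → a + b ≡ (a + x) + (x + b) - + 2 * x
    regroup = solve-∀
    collect : ∀ x → + 3 * (+ 3 * x) - + 2 * x ≡ + 7 * x
    collect = solve-∀

  skip2-±6 : ∀ c → H (c + + 6) + H (c - + 6) ≡ + 18 * H c
  skip2-±6 c = begin
    H (c + + 6) + H (c - + 6)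
      ≡⟨ regroup (H (c + + 6)) (H (c - + 6)) (H (c + + 2)) (H (c - + 2)) ⟩
    (H (c + + 6) + H (c + + 2)) + (H (c - + 2) + H (c - + 6)) - (H (c + + 2) + H (c - + 2))
      ≡⟨ cong₂ (λ x y → x + y - (H (c + + 2) + H (c - + 2)))
               (skip2-at (c + + 4) (solve (c ∷ [])) (solve (c ∷ [])))
               (skip2-at (c - + 4) (solve (c ∷ [])) (solve (c ∷ []))) ⟩
    + 3 * H (c + + 4) + + 3 * H (c - + 4) - (H (c + + 2) + H (c - + 2))
      ≡⟨ cong₂ _-_ (sym (ℤP.*-distribˡ-+ (+ 3) (H (c + + 4)) (H (c - + 4)))) (skip2 c) ⟩
    + 3 * (H (c + + 4) + H (c - + 4)) - + 3 * H c
      ≡⟨ cong (λ x → + 3 * x - + 3 * H c) (skip2-±4 c) ⟩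
    + 3 * (+ 7 * H c) - + 3 * H c
      ≡⟨ collect (H c) ⟩
    + 18 * H c ∎
    where
    regroup : ∀ a b x y → a + b ≡ (a + x) + (y + b) - (x + y)
    regroup = solve-∀
    collect : ∀ x → + 3 * (+ 7 * x) - + 3 * x ≡ + 18 * x
    collect = solve-∀

module CentralBinomialConvolution (G : ℤ → ℤ) where

  term : ℤ → ℕ → ℕ → ℤ
  term r i j = + central i * + central j * G (r + + 2 * + i)

  T A B : ℕ → ℤ → ℤ
  T n r = sumAntidiagonal n (term r)
  A n r = sumAntidiagonal n (λ i j → (+ 4 * + i + + 2) * term r i j)
  B n r = sumAntidiagonal n (λ i j → (+ 4 * + j + + 2) * term r i j)

  private
    central-absorbℤ : ∀ i → + suc i * + central (suc i) ≡ (+ 4 * + i + + 2) * + central i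
    central-absorbℤ i =
      trans (*≡*⇒pos*pos≡pos*pos (suc i) (central (suc i)) (4 ℕ.* i ℕ.+ 2) (central i)
                                 (central-absorb i))
            (cong (λ x → (x + + 2) * + central i) (ℤP.pos-* 4 i))

    spread : ∀ x t → (+ 4 * x + + 2) * t ≡ + 4 * (x * t) + + 2 * t
    spread = solve-∀

  i-moment-suc : ∀ n r → sumAntidiagonal (suc n) (λ i j → + i * term r i j) ≡ A n (r + + 2)
  i-moment-suc n r =
    trans (sumAntidiagonal-dropˡ n (λ i j → + i * term r i j) refl)
          (sumAntidiagonal-cong n absorb)
    where
    absorb : ∀ i j → + suc i * term r (suc i) j ≡ (+ 4 * + i + + 2) * term (r + + 2) i j
    absorb i j = begin
      + suc i * (+ central (suc i) * + central j * G (r + + 2 * + suc i))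
        ≡⟨ pull (+ suc i) (+ central (suc i)) (+ central j) _ ⟩
      (+ suc i * + central (suc i)) * + central j * G (r + + 2 * + suc i)
        ≡⟨ cong₂ (λ x y → x * + central j * G y) (central-absorbℤ i) (shift r (+ i)) ⟩
      ((+ 4 * + i + + 2) * + central i) * + central j * G ((r + + 2) + + 2 * + i)
        ≡⟨ push (+ 4 * + i + + 2) (+ central i) (+ central j) _ ⟩
      (+ 4 * + i + + 2) * term (r + + 2) i j ∎
      where
      pull : ∀ s a b g → s * (a * b * g) ≡ (s * a) * b * g
      pull = solve-∀
      push : ∀ w a b g → (w * a) * b * g ≡ w * (a * b * g)
      push = solve-∀
      shift : ∀ r x → r + + 2 * (+ 1 + x) ≡ (r + + 2) + + 2 * x
      shift = solve-∀

  j-moment-suc : ∀ n r → sumAntidiagonal (suc n) (λ i j → + j * term r i j) ≡ B n r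
  j-moment-suc n r =
    trans (sumAntidiagonal-dropʳ n (λ i j → + j * term r i j) refl)
          (sumAntidiagonal-cong n absorb)
    where
    absorb : ∀ i j → + suc j * term r i (suc j) ≡ (+ 4 * + j + + 2) * term r i j
    absorb i j = begin
      + suc j * (+ central i * + central (suc j) * G (r + + 2 * + i))
        ≡⟨ pull (+ suc j) (+ central i) (+ central (suc j)) _ ⟩
      + central i * (+ suc j * + central (suc j)) * G (r + + 2 * + i)
        ≡⟨ cong (λ x → + central i * x * G (r + + 2 * + i)) (central-absorbℤ j) ⟩
      + central i * ((+ 4 * + j + + 2) * + central j) * G (r + + 2 * + i)
        ≡⟨ push (+ 4 * + j + + 2) (+ central i) (+ central j) _ ⟩
      (+ 4 * + j + + 2) * term r i j ∎
      where
      pull : ∀ s a b g → s * (a * b * g) ≡ a * (s * b) * g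
      pull = solve-∀
      push : ∀ w a b g → a * (w * b) * g ≡ w * (a * b * g)
      push = solve-∀

  T-suc : ∀ n r → + suc n * T (suc n) r ≡ A n (r + + 2) + B n r
  T-suc n r = trans (sumAntidiagonal-split (suc n) (term r))
                    (cong₂ _+_ (i-moment-suc n r) (j-moment-suc n r))

  A-suc : ∀ n r → A (suc n) r ≡ + 4 * A n (r + + 2) + + 2 * T (suc n) r
  A-suc n r = begin
    A (suc n) r
      ≡⟨ sumAntidiagonal-cong (suc n) (λ i j → spread (+ i) (term r i j)) ⟩
    sumAntidiagonal (suc n) (λ i j → + 4 * (+ i * term r i j) + + 2 * term r i j)
      ≡⟨ sumAntidiagonal-linear (suc n) (+ 4) (+ 2) (λ i j → + i * term r i j) (term r) ⟩
    + 4 * sumAntidiagonal (suc n) (λ i j → + i * term r i j) + + 2 * T (suc n) r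
      ≡⟨ cong (λ x → + 4 * x + + 2 * T (suc n) r) (i-moment-suc n r) ⟩
    + 4 * A n (r + + 2) + + 2 * T (suc n) r ∎

  B-suc : ∀ n r → B (suc n) r ≡ + 4 * B n r + + 2 * T (suc n) r
  B-suc n r = begin
    B (suc n) r
      ≡⟨ sumAntidiagonal-cong (suc n) (λ i j → spread (+ j) (term r i j)) ⟩
    sumAntidiagonal (suc n) (λ i j → + 4 * (+ j * term r i j) + + 2 * term r i j)
      ≡⟨ sumAntidiagonal-linear (suc n) (+ 4) (+ 2) (λ i j → + j * term r i j) (term r) ⟩
    + 4 * sumAntidiagonal (suc n) (λ i j → + j * term r i j) + + 2 * T (suc n) r
      ≡⟨ cong (λ x → + 4 * x + + 2 * T (suc n) r) (j-moment-suc n r) ⟩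
    + 4 * B n r + + 2 * T (suc n) r ∎

  A+B : ∀ n r → A n r + B n r ≡ + 4 * + suc n * T n r
  A+B n r = begin
    A n r + B n r
      ≡⟨ sumAntidiagonal-+ n _ _ ⟨
    sumAntidiagonal n (λ i j → (+ 4 * + i + + 2) * term r i j + (+ 4 * + j + + 2) * term r i j)
      ≡⟨ sumAntidiagonal-cong n (λ i j → collect (+ i) (+ j) (term r i j)) ⟩
    sumAntidiagonal n (λ i j → + 4 * + suc (i ℕ.+ j) * term r i j)
      ≡⟨ sumAntidiagonal-weight n (λ k → + 4 * + suc k) (term r) ⟩
    + 4 * + suc n * T n r ∎
    where
    collect : ∀ x y t → (+ 4 * x + + 2) * t + (+ 4 * y + + 2) * t ≡ + 4 * (+ 1 + (x + y)) * t
    collect = solve-∀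

  T-recurrence : ∀ n r → + suc (suc n) * T (suc (suc n)) r
    ≡ (+ 4 * + n + + 6) * (T (suc n) r + T (suc n) (r + + 2)) - + 16 * + suc n * T n (r + + 2)
  T-recurrence n r = begin
    + suc (suc n) * T (suc (suc n)) r
      ≡⟨ T-suc (suc n) r ⟩
    A (suc n) r₂ + B (suc n) r
      ≡⟨ cong₂ _+_ (A-suc n r₂) (B-suc n r) ⟩
    (+ 4 * A n r₄ + + 2 * T₁ r₂) + (+ 4 * B n r + + 2 * T₁ r)
      ≡⟨ regroup (A n r₂) (B n r) (A n r₄) (B n r₂) (T₁ r) (T₁ r₂) ⟩
    + 4 * ((A n r₂ + B n r) + (A n r₄ + B n r₂) - (A n r₂ + B n r₂)) + + 2 * (T₁ r + T₁ r₂)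
      ≡⟨ cong₂ (λ x y → + 4 * (x + y - (A n r₂ + B n r₂)) + + 2 * (T₁ r + T₁ r₂))
               (T-suc n r) (T-suc n r₂) ⟨
    + 4 * (s * T₁ r + s * T₁ r₂ - (A n r₂ + B n r₂)) + + 2 * (T₁ r + T₁ r₂)
      ≡⟨ cong (λ x → + 4 * (s * T₁ r + s * T₁ r₂ - x) + + 2 * (T₁ r + T₁ r₂)) (A+B n r₂) ⟩
    + 4 * (s * T₁ r + s * T₁ r₂ - + 4 * s * T n r₂) + + 2 * (T₁ r + T₁ r₂)
      ≡⟨ collect (+ n) (T₁ r) (T₁ r₂) (T n r₂) ⟩
    (+ 4 * + n + + 6) * (T₁ r + T₁ r₂) - + 16 * s * T n r₂ ∎
    where
    s r₂ r₄ : ℤ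
    s  = + suc n
    r₂ = r + + 2
    r₄ = r₂ + + 2
    T₁ : ℤ → ℤ
    T₁ = T (suc n)
    regroup : ∀ a b a′ b′ t t′ →
      (+ 4 * a′ + + 2 * t′) + (+ 4 * b + + 2 * t)
        ≡ + 4 * ((a + b) + (a′ + b′) - (a + b′)) + + 2 * (t + t′)
    regroup = solve-∀
    collect : ∀ x a b c →
      + 4 * ((+ 1 + x) * a + (+ 1 + x) * b - + 4 * (+ 1 + x) * c) + + 2 * (a + b)
        ≡ (+ 4 * x + + 6) * (a + b) - + 16 * (+ 1 + x) * c
    collect = solve-∀

module PascalSquareConvolution (G : ℤ → ℤ) where

  -- With i = k and j = n - k the index 6k - 2n + r of the statement is r + 4i - 2j.
  term : ℤ → ℕ → ℕ → ℤ
  term r i j = + pascal i j * + pascal i j * G (r + + 4 * + i - + 2 * + j)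

  moment : ℕ → ℕ → ℕ → ℤ → ℤ
  moment a b n r = sumAntidiagonal n (λ i j → (+ i) ^ a * (+ j) ^ b * term r i j)

  P Q R N : ℕ → ℤ → ℤ
  P = moment 0 0
  Q = moment 1 0
  R = moment 0 1
  N n r = R n (r + + 4) + Q n (r - + 2)

  private
    pascal-absorbˡℤ : ∀ i j → + suc i * + pascal (suc i) j ≡ + suc (i ℕ.+ j) * + pascal i j
    pascal-absorbˡℤ i j =
      *≡*⇒pos*pos≡pos*pos (suc i) (pascal (suc i) j) (suc (i ℕ.+ j)) (pascal i j) (pascal-absorbˡ i j)
    pascal-absorbʳℤ : ∀ i j → + suc j * + pascal i (suc j) ≡ + suc (i ℕ.+ j) * + pascal i j
    pascal-absorbʳℤ i j =
      *≡*⇒pos*pos≡pos*pos (suc j) (pascal i (suc j)) (suc (i ℕ.+ j)) (pascal i j) (pascal-absorbʳ i j)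

  moment-split : ∀ a b n r →
    + n * moment a b n r ≡ moment (suc a) b n r + moment a (suc b) n r
  moment-split a b n r =
    trans (sumAntidiagonal-split n (λ i j → (+ i) ^ a * (+ j) ^ b * term r i j))
          (cong₂ _+_ (sumAntidiagonal-cong n (λ i j → pushˡ (+ i) ((+ i) ^ a) ((+ j) ^ b) (term r i j)))
                     (sumAntidiagonal-cong n (λ i j → pushʳ (+ j) ((+ i) ^ a) ((+ j) ^ b) (term r i j))))
    where
    pushˡ : ∀ s x y t → s * (x * y * t) ≡ s * x * y * t
    pushˡ = solve-∀
    pushʳ : ∀ s x y t → s * (x * y * t) ≡ x * (s * y) * t
    pushʳ = solve-∀

  moment-absorbˡ : ∀ b n r → moment 2 b (suc n) r ≡ + suc n * + suc n * moment 0 b n (r + + 4)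
  moment-absorbˡ b n r =
    trans (sumAntidiagonal-dropˡ n (λ i j → (+ i) ^ 2 * (+ j) ^ b * term r i j) refl)
          (trans (sumAntidiagonal-cong n absorb)
                 (sumAntidiagonal-weight n (λ k → + suc k * + suc k)
                                         (λ i j → + 1 * (+ j) ^ b * term (r + + 4) i j)))
    where
    absorb : ∀ i j → (+ suc i) ^ 2 * (+ j) ^ b * term r (suc i) j
                     ≡ + suc (i ℕ.+ j) * + suc (i ℕ.+ j) * (+ 1 * (+ j) ^ b * term (r + + 4) i j)
    absorb i j = begin
      s ^ 2 * y * (p′ * p′ * G (r + + 4 * s - + 2 * + j))
        ≡⟨ square-in s y p′ _ ⟩
      (s * p′) * (s * p′) * (y * G (r + + 4 * s - + 2 * + j))
        ≡⟨ cong₂ (λ x z → x * x * (y * G z)) (pascal-absorbˡℤ i j) (shift r (+ i) (+ j)) ⟩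
      (t * p) * (t * p) * (y * G ((r + + 4) + + 4 * + i - + 2 * + j))
        ≡⟨ square-out t y p _ ⟩
      t * t * (+ 1 * y * term (r + + 4) i j) ∎
      where
      s t y p p′ : ℤ
      s  = + suc i
      t  = + suc (i ℕ.+ j)
      y  = (+ j) ^ b
      p  = + pascal i j
      p′ = + pascal (suc i) j
      square-in : ∀ s y p g → s * (s * + 1) * y * (p * p * g) ≡ (s * p) * (s * p) * (y * g)
      square-in = solve-∀
      square-out : ∀ s y p g → (s * p) * (s * p) * (y * g) ≡ s * s * (+ 1 * y * (p * p * g))
      square-out = solve-∀
      shift : ∀ r x y → r + + 4 * (+ 1 + x) - + 2 * y ≡ (r + + 4) + + 4 * x - + 2 * y
      shift = solve-∀

  moment-absorbʳ : ∀ a n r → moment a 2 (suc n) r ≡ + suc n * + suc n * moment a 0 n (r - + 2)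
  moment-absorbʳ a n r =
    trans (sumAntidiagonal-dropʳ n (λ i j → (+ i) ^ a * (+ j) ^ 2 * term r i j)
                                 (cong (_* term r (suc n) 0) (ℤP.*-zeroʳ ((+ suc n) ^ a))))
          (trans (sumAntidiagonal-cong n absorb)
                 (sumAntidiagonal-weight n (λ k → + suc k * + suc k)
                                         (λ i j → (+ i) ^ a * + 1 * term (r - + 2) i j)))
    where
    absorb : ∀ i j → (+ i) ^ a * (+ suc j) ^ 2 * term r i (suc j)
                     ≡ + suc (i ℕ.+ j) * + suc (i ℕ.+ j) * ((+ i) ^ a * + 1 * term (r - + 2) i j)
    absorb i j = begin
      x * s ^ 2 * (p′ * p′ * G (r + + 4 * + i - + 2 * s))
        ≡⟨ square-in s x p′ _ ⟩
      (s * p′) * (s * p′) * (x * G (r + + 4 * + i - + 2 * s))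
        ≡⟨ cong₂ (λ y z → y * y * (x * G z)) (pascal-absorbʳℤ i j) (shift r (+ i) (+ j)) ⟩
      (t * p) * (t * p) * (x * G ((r - + 2) + + 4 * + i - + 2 * + j))
        ≡⟨ square-out t x p _ ⟩
      t * t * (x * + 1 * term (r - + 2) i j) ∎
      where
      s t x p p′ : ℤ
      s  = + suc j
      t  = + suc (i ℕ.+ j)
      x  = (+ i) ^ a
      p  = + pascal i j
      p′ = + pascal i (suc j)
      square-in : ∀ s x p g → x * (s * (s * + 1)) * (p * p * g) ≡ (s * p) * (s * p) * (x * g)
      square-in = solve-∀
      square-out : ∀ s x p g → (s * p) * (s * p) * (x * g) ≡ s * s * (x * + 1 * (p * p * g))
      square-out = solve-∀
      shift : ∀ r x y → r + + 4 * x - + 2 * (+ 1 + y) ≡ (r - + 2) + + 4 * x - + 2 * y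
      shift = solve-∀

  M-suc : ∀ n r → moment 1 1 (suc n) r ≡ + suc n * N n r
  M-suc n r = ℤP.*-cancelˡ-≡ (+ suc n) _ _ (begin
    + suc n * moment 1 1 (suc n) r
      ≡⟨ moment-split 1 1 (suc n) r ⟩
    moment 2 1 (suc n) r + moment 1 2 (suc n) r
      ≡⟨ cong₂ _+_ (moment-absorbˡ 1 n r) (moment-absorbʳ 1 n r) ⟩
    + suc n * + suc n * R n (r + + 4) + + suc n * + suc n * Q n (r - + 2)
      ≡⟨ factor (+ suc n) (R n (r + + 4)) (Q n (r - + 2)) ⟩
    + suc n * (+ suc n * N n r) ∎)
    where
    factor : ∀ s x y → s * s * x + s * s * y ≡ s * (s * (x + y))
    factor = solve-∀

  Q-suc : ∀ n r → Q (suc n) r ≡ + suc n * P n (r + + 4) + N n r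
  Q-suc n r = ℤP.*-cancelˡ-≡ (+ suc n) _ _ (begin
    + suc n * Q (suc n) r
      ≡⟨ moment-split 1 0 (suc n) r ⟩
    moment 2 0 (suc n) r + moment 1 1 (suc n) r
      ≡⟨ cong₂ _+_ (moment-absorbˡ 0 n r) (M-suc n r) ⟩
    + suc n * + suc n * P n (r + + 4) + + suc n * N n r
      ≡⟨ factor (+ suc n) (P n (r + + 4)) (N n r) ⟩
    + suc n * (+ suc n * P n (r + + 4) + N n r) ∎)
    where
    factor : ∀ s x y → s * s * x + s * y ≡ s * (s * x + y)
    factor = solve-∀

  R-suc : ∀ n r → R (suc n) r ≡ N n r + + suc n * P n (r - + 2)
  R-suc n r = ℤP.*-cancelˡ-≡ (+ suc n) _ _ (begin
    + suc n * R (suc n) r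
      ≡⟨ moment-split 0 1 (suc n) r ⟩
    moment 1 1 (suc n) r + moment 0 2 (suc n) r
      ≡⟨ cong₂ _+_ (M-suc n r) (moment-absorbʳ 0 n r) ⟩
    + suc n * N n r + + suc n * + suc n * P n (r - + 2)
      ≡⟨ factor (+ suc n) (N n r) (P n (r - + 2)) ⟩
    + suc n * (N n r + + suc n * P n (r - + 2)) ∎)
    where
    factor : ∀ s x y → s * x + s * s * y ≡ s * (x + s * y)
    factor = solve-∀

  P-suc : ∀ n r → + suc n * P (suc n) r ≡ + suc n * (P n (r + + 4) + P n (r - + 2)) + + 2 * N n r
  P-suc n r = begin
    + suc n * P (suc n) r
      ≡⟨ moment-split 0 0 (suc n) r ⟩
    Q (suc n) r + R (suc n) r
      ≡⟨ cong₂ _+_ (Q-suc n r) (R-suc n r) ⟩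
    (+ suc n * P n (r + + 4) + N n r) + (N n r + + suc n * P n (r - + 2))
      ≡⟨ collect (+ suc n) (P n (r + + 4)) (P n (r - + 2)) (N n r) ⟩
    + suc n * (P n (r + + 4) + P n (r - + 2)) + + 2 * N n r ∎
    where
    collect : ∀ s x y z → (s * x + z) + (z + s * y) ≡ s * (x + y) + + 2 * z
    collect = solve-∀

  P-suc-suc : ∀ n r → + suc (suc n) * P (suc (suc n)) r
    ≡ (+ 2 * + suc n + + 1) * (P (suc n) (r + + 4) + P (suc n) (r - + 2))
      - + suc n * (P n ((r + + 4) + + 4) + P n ((r - + 2) - + 2) - + 2 * P n (r + + 2))
  P-suc-suc n r = begin
    + suc (suc n) * P (suc (suc n)) r
      ≡⟨ P-suc (suc n) r ⟩
    S * Σ₁ + + 2 * N (suc n) r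
      ≡⟨ cong (λ x → S * Σ₁ + + 2 * x) (cong₂ _+_ (R-suc n r₊) (Q-suc n r₋)) ⟩
    S * Σ₁ + + 2 * ((N n r₊ + s * P n (r₊ - + 2)) + (s * P n (r₋ + + 4) + N n r₋))
      ≡⟨ regroup S s Σ₁ (N n r₊) (N n r₋)
                 (P n (r₊ + + 4)) (P n (r₊ - + 2)) (P n (r₋ + + 4)) (P n (r₋ - + 2)) ⟩
    S * Σ₁ + ((s * (P n (r₊ + + 4) + P n (r₊ - + 2)) + + 2 * N n r₊)
              + (s * (P n (r₋ + + 4) + P n (r₋ - + 2)) + + 2 * N n r₋))
      - s * (P n (r₊ + + 4) + P n (r₋ - + 2) - P n (r₊ - + 2) - P n (r₋ + + 4))
      ≡⟨ cong₂ (λ x y → S * Σ₁ + (x + y)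
                        - s * (P n (r₊ + + 4) + P n (r₋ - + 2) - P n (r₊ - + 2) - P n (r₋ + + 4)))
               (P-suc n r₊) (P-suc n r₋) ⟨
    S * Σ₁ + (s * P₁ r₊ + s * P₁ r₋)
      - s * (P n (r₊ + + 4) + P n (r₋ - + 2) - P n (r₊ - + 2) - P n (r₋ + + 4))
      ≡⟨ cong₂ (λ x y → S * Σ₁ + (s * P₁ r₊ + s * P₁ r₋)
                        - s * (P n (r₊ + + 4) + P n (r₋ - + 2) - P n x - P n y))
               (ℤP.+-assoc r (+ 4) (- + 2)) (ℤP.+-assoc r (- + 2) (+ 4)) ⟩
    S * Σ₁ + (s * P₁ r₊ + s * P₁ r₋)
      - s * (P n (r₊ + + 4) + P n (r₋ - + 2) - P n (r + + 2) - P n (r + + 2))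
      ≡⟨ collect s (P₁ r₊) (P₁ r₋) (P n (r₊ + + 4)) (P n (r₋ - + 2)) (P n (r + + 2)) ⟩
    (+ 2 * s + + 1) * Σ₁ - s * (P n (r₊ + + 4) + P n (r₋ - + 2) - + 2 * P n (r + + 2)) ∎
    where
    S s r₊ r₋ Σ₁ : ℤ
    S  = + suc (suc n)
    s  = + suc n
    r₊ = r + + 4
    r₋ = r - + 2
    P₁ : ℤ → ℤ
    P₁ = P (suc n)
    Σ₁ = P₁ r₊ + P₁ r₋
    regroup : ∀ S s Σ₁ n₊ n₋ p₊₊ p₊₋ p₋₊ p₋₋ →
      S * Σ₁ + + 2 * ((n₊ + s * p₊₋) + (s * p₋₊ + n₋))
        ≡ S * Σ₁ + ((s * (p₊₊ + p₊₋) + + 2 * n₊) + (s * (p₋₊ + p₋₋) + + 2 * n₋))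
          - s * (p₊₊ + p₋₋ - p₊₋ - p₋₊)
    regroup = solve-∀
    collect : ∀ s x y p₊ p₋ p →
      (+ 1 + s) * (x + y) + (s * x + s * y) - s * (p₊ + p₋ - p - p)
        ≡ (+ 2 * s + + 1) * (x + y) - s * (p₊ + p₋ - + 2 * p)
    collect = solve-∀

  moment-skip2 : Skip2Recurrence G → ∀ a b n → Skip2Recurrence (moment a b n)
  moment-skip2 skip2 a b n r = begin
    moment a b n (r + + 2) + moment a b n (r - + 2)
      ≡⟨ sumAntidiagonal-+ n _ _ ⟨
    sumAntidiagonal n (λ i j → k i j * term (r + + 2) i j + k i j * term (r - + 2) i j)
      ≡⟨ sumAntidiagonal-cong n pointwise ⟩
    sumAntidiagonal n (λ i j → + 3 * (k i j * term r i j))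
      ≡⟨ sumAntidiagonal-*ˡ n (+ 3) (λ i j → k i j * term r i j) ⟩
    + 3 * moment a b n r ∎
    where
    k : ℕ → ℕ → ℤ
    k i j = (+ i) ^ a * (+ j) ^ b
    pointwise : ∀ i j → k i j * term (r + + 2) i j + k i j * term (r - + 2) i j
                        ≡ + 3 * (k i j * term r i j)
    pointwise i j = begin
      k i j * (w * G (index (+ 2))) + k i j * (w * G (index (- + 2)))
        ≡⟨ factor (k i j) w (G (index (+ 2))) (G (index (- + 2))) ⟩
      k i j * w * (G (index (+ 2)) + G (index (- + 2)))
        ≡⟨ cong₂ (λ x y → k i j * w * (G x + G y))
                 (shift r (+ 2) (+ i) (+ j)) (shift r (- + 2) (+ i) (+ j)) ⟩
      k i j * w * (G (c + + 2) + G (c - + 2))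
        ≡⟨ cong (k i j * w *_) (skip2 c) ⟩
      k i j * w * (+ 3 * G c)
        ≡⟨ unfactor (k i j) w (G c) ⟩
      + 3 * (k i j * term r i j) ∎
      where
      w c : ℤ
      w = + pascal i j * + pascal i j
      c = r + + 4 * + i - + 2 * + j
      index : ℤ → ℤ
      index d = (r + d) + + 4 * + i - + 2 * + j
      factor : ∀ k w g g′ → k * (w * g) + k * (w * g′) ≡ k * w * (g + g′)
      factor = solve-∀
      shift : ∀ r d x y → (r + d) + + 4 * x - + 2 * y ≡ (r + + 4 * x - + 2 * y) + d
      shift = solve-∀
      unfactor : ∀ k w g → k * w * (+ 3 * g) ≡ + 3 * (k * (w * g))
      unfactor = solve-∀

module _ {G : ℤ → ℤ} (skip2 : Skip2Recurrence G) where
  open CentralBinomialConvolution G using (T; T-recurrence)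
  open PascalSquareConvolution G using (P; P-suc-suc; moment-skip2)

  P-recurrence : ∀ n r → + suc (suc n) * P (suc (suc n)) r
    ≡ (+ 4 * + n + + 6) * (P (suc n) r + P (suc n) (r + + 2)) - + 16 * + suc n * P n (r + + 2)
  P-recurrence n r = begin
    + suc (suc n) * P (suc (suc n)) r
      ≡⟨ P-suc-suc n r ⟩
    (+ 2 * + suc n + + 1) * (P (suc n) (r + + 4) + P (suc n) (r - + 2))
      - + suc n * (P n ((r + + 4) + + 4) + P n ((r - + 2) - + 2) - + 2 * P n (r + + 2))
      ≡⟨ cong₂ (λ x y → (+ 2 * + suc n + + 1) * x - + suc n * (y - + 2 * P n (r + + 2)))
               (skip2-+4-2 (moment-skip2 skip2 0 0 (suc n)) r)
               (trans (cong₂ (λ x y → P n x + P n y) (index₊ r) (index₋ r))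
                      (skip2-±6 (moment-skip2 skip2 0 0 n) (r + + 2))) ⟩
    (+ 2 * + suc n + + 1) * (+ 2 * P (suc n) r + + 2 * P (suc n) (r + + 2))
      - + suc n * (+ 18 * P n (r + + 2) - + 2 * P n (r + + 2))
      ≡⟨ collect (+ n) (P (suc n) r) (P (suc n) (r + + 2)) (P n (r + + 2)) ⟩
    (+ 4 * + n + + 6) * (P (suc n) r + P (suc n) (r + + 2)) - + 16 * + suc n * P n (r + + 2) ∎
    where
    index₊ : ∀ r → (r + + 4) + + 4 ≡ (r + + 2) + + 6
    index₊ = solve-∀
    index₋ : ∀ r → (r - + 2) - + 2 ≡ (r + + 2) - + 6
    index₋ = solve-∀
    collect : ∀ x a b c →
      (+ 2 * (+ 1 + x) + + 1) * (+ 2 * a + + 2 * b) - (+ 1 + x) * (+ 18 * c - + 2 * c)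
        ≡ (+ 4 * x + + 6) * (a + b) - + 16 * (+ 1 + x) * c
    collect = solve-∀

  T≡P : ∀ n r → T n r ≡ P n r
  T≡P zero          r = begin
    T 0 r
      ≡⟨⟩
    + 1 * G (r + + 0)
      ≡⟨ cong (λ x → + 1 * G x) (ℤP.+-identityʳ (r + + 0)) ⟨
    + 1 * G ((r + + 0) + + 0)
      ≡⟨ cong (+ 1 *_) (ℤP.*-identityˡ (G ((r + + 0) + + 0))) ⟨
    P 0 r ∎
  T≡P (suc zero)    r = begin
    T 1 r
      ≡⟨⟩
    + 2 * G (r + + 0) + + 2 * G (r + + 2)
      ≡⟨ cong (λ x → + 2 * G x + + 2 * G (r + + 2)) (ℤP.+-identityʳ r) ⟩
    + 2 * G r + + 2 * G (r + + 2)
      ≡⟨ skip2-+4-2 skip2 r ⟨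
    G (r + + 4) + G (r - + 2)
      ≡⟨ ℤP.+-comm (G (r + + 4)) (G (r - + 2)) ⟩
    G (r - + 2) + G (r + + 4)
      ≡⟨ cong₂ (λ x y → G (x - + 2) + G y) (ℤP.+-identityʳ r) (ℤP.+-identityʳ (r + + 4)) ⟨
    G ((r + + 0) - + 2) + G ((r + + 4) + + 0)
      ≡⟨ cong₂ _+_ (one-one (G ((r + + 0) - + 2))) (one-one (G ((r + + 4) + + 0))) ⟨
    P 1 r ∎
    where
    one-one : ∀ x → + 1 * (+ 1 * x) ≡ x
    one-one = solve-∀
  T≡P (suc (suc n)) r = ℤP.*-cancelˡ-≡ (+ suc (suc n)) _ _ (begin
    + suc (suc n) * T (suc (suc n)) r
      ≡⟨ T-recurrence n r ⟩
    (+ 4 * + n + + 6) * (T (suc n) r + T (suc n) (r + + 2)) - + 16 * + suc n * T n (r + + 2)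
      ≡⟨ cong₂ (λ x y → (+ 4 * + n + + 6) * x - + 16 * + suc n * y)
               (cong₂ _+_ (T≡P (suc n) r) (T≡P (suc n) (r + + 2))) (T≡P n (r + + 2)) ⟩
    (+ 4 * + n + + 6) * (P (suc n) r + P (suc n) (r + + 2)) - + 16 * + suc n * P n (r + + 2)
      ≡⟨ P-recurrence n r ⟨
    + suc (suc n) * P (suc (suc n)) r ∎)

  convolution-identity : ∀ r n →
    sumTo n (λ k → (+ ((2 ℕ.* k) C k)) * (+ ((2 ℕ.* (n ∸ k)) C (n ∸ k))) * G ((+ (2 ℕ.* k)) + r))
      ≡ sumTo n (λ k → (+ (n C k)) * (+ (n C k)) * G ((+ (6 ℕ.* k)) - (+ (2 ℕ.* n)) + r))
  convolution-identity r n = begin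
    sumTo n (λ k → + ((2 ℕ.* k) C k) * + ((2 ℕ.* (n ∸ k)) C (n ∸ k)) * G (+ (2 ℕ.* k) + r))
      ≡⟨ sumTo-cong n (λ k _ → lhs-term k) ⟨
    sumTo n (λ k → CentralBinomialConvolution.term G r k (n ∸ k))
      ≡⟨ sumAntidiagonal≡sumTo n _ ⟨
    T n r
      ≡⟨ T≡P n r ⟩
    P n r
      ≡⟨ sumAntidiagonal≡sumTo n _ ⟩
    sumTo n (λ k → + 1 * PascalSquareConvolution.term G r k (n ∸ k))
      ≡⟨ sumTo-cong n rhs-term ⟩
    sumTo n (λ k → + (n C k) * + (n C k) * G (+ (6 ℕ.* k) - + (2 ℕ.* n) + r)) ∎
    where
    lhs-term : ∀ k → + central k * + central (n ∸ k) * G (r + + 2 * + k)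
                     ≡ + ((2 ℕ.* k) C k) * + ((2 ℕ.* (n ∸ k)) C (n ∸ k)) * G (+ (2 ℕ.* k) + r)
    lhs-term k = cong₂ (λ x y → x * G y)
                       (cong₂ (λ a b → + a * + b) (central≡C k) (central≡C (n ∸ k)))
                       (trans (ℤP.+-comm r (+ 2 * + k)) (cong (_+ r) (sym (ℤP.pos-* 2 k))))
    rhs-term : ∀ k → k ℕ.≤ n →
               + 1 * (+ pascal k (n ∸ k) * + pascal k (n ∸ k) * G (r + + 4 * + k - + 2 * + (n ∸ k)))
               ≡ + (n C k) * + (n C k) * G (+ (6 ℕ.* k) - + (2 ℕ.* n) + r)
    rhs-term k k≤n = trans (ℤP.*-identityˡ _) (cong₂ (λ x y → + x * + x * G y) pascal≡nCk index)
      where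
      k+d≡n : k ℕ.+ (n ∸ k) ≡ n
      k+d≡n = ℕP.m+[n∸m]≡n k≤n
      pascal≡nCk : pascal k (n ∸ k) ≡ n C k
      pascal≡nCk = trans (pascal≡C k (n ∸ k)) (cong (_C k) k+d≡n)
      rearrange : ∀ r x y → r + + 4 * x - + 2 * y ≡ + 6 * x - + 2 * (x + y) + r
      rearrange = solve-∀
      index : r + + 4 * + k - + 2 * + (n ∸ k) ≡ + (6 ℕ.* k) - + (2 ℕ.* n) + r
      index = begin
        r + + 4 * + k - + 2 * + (n ∸ k)
          ≡⟨ rearrange r (+ k) (+ (n ∸ k)) ⟩
        + 6 * + k - + 2 * + (k ℕ.+ (n ∸ k)) + r
          ≡⟨ cong (λ m → + 6 * + k - + 2 * + m + r) k+d≡n ⟩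
        + 6 * + k - + 2 * + n + r
          ≡⟨ cong₂ (λ x y → x - y + r) (ℤP.pos-* 6 k) (ℤP.pos-* 2 n) ⟨
        + (6 ℕ.* k) - + (2 ℕ.* n) + r ∎

theorem20 : (r : ℤ) (n : ℕ) →
    (sumTo n (λ k → (+ ((2 ℕ.* k) C k)) * (+ ((2 ℕ.* (n ∸ k)) C (n ∸ k))) * F ((+ (2 ℕ.* k)) + r))
      ≡ sumTo n (λ k → (+ (n C k)) * (+ (n C k)) * F ((+ (6 ℕ.* k)) - (+ (2 ℕ.* n)) + r)))
    ×
    (sumTo n (λ k → (+ ((2 ℕ.* k) C k)) * (+ ((2 ℕ.* (n ∸ k)) C (n ∸ k))) * L ((+ (2 ℕ.* k)) + r))
      ≡ sumTo n (λ k → (+ (n C k)) * (+ (n C k)) * L ((+ (6 ℕ.* k)) - (+ (2 ℕ.* n)) + r)))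
theorem20 r n =
  convolution-identity {F} (fibonacci⇒skip2 (seqℤ-fibonacci (+ 0) (+ 1))) r n ,
  convolution-identity {L} (fibonacci⇒skip2 (seqℤ-fibonacci (+ 2) (+ 1))) r n
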